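{- Let $k\ge1$ and let $G=(V,E)$ be any graph on $t\ge k+2$ vertices. Let $G'$ be obtained from $G$ by adding, for each $(k+1)$-element subset $K\subset V$, a new vertex $v_K$ adjacent exactly to the vertices of $K$. Let $H$ be the neighborhood hypergraph of $G'$. Then $\chi_{k\text{ -cf}}(H)=\chi_{k\text{ -cf}}(G')\ge \frac{t}{k}=\Omega\!\left(n^{\frac{1}{k+1}}\right)$, where $n=\binom{t}{k+1}+t$ is the number of vertices of $G'$.
   Context: For a graph $G=(V,E)$ and $v\in V$, $N_G(v)=\{u:\{u,v\}\in E\}$; the neighborhood hypergraph of $G$ has vertex set $V$ and hyperedges $N_G(v)$ for all $v\in V$. A $k$-CF-coloring of a hypergraph is a coloring of its vertices such that every nonempty hyperedge $S$ contains a color $i$ with $1\le|S\cap c^{ -1}(i)|\le k$; a $k$-CF-coloring of a graph is a $k$-CF-coloring of its neighborhood hypergraph; $\chi_{k\text{ -cf}}$ denotes the minimum number of colors in such a coloring. -}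

module Defs where

open import Data.Nat using (ℕ; suc; _≤_)
open import Data.Fin using (Fin; _≟_)
open import Data.Fin.Subset using (Subset; _∩_; ∣_∣; Nonempty)
open import Data.Vec using (tabulate; lookup)
open import Data.Bool using (Bool; false)
open import Data.Product using (∃; ∃₂; _×_)
open import Data.Sum using (_⊎_)
open import Relation.Nullary using (does; ¬_)
open import Relation.Binary.PropositionalEquality using (_≡_)

record Graph (n : ℕ) : Set where
  field
    adj    : Fin n → Fin n → Bool
    sym    : ∀ u v → adj u v ≡ adj v u
    irrefl : ∀ v → adj v v ≡ false
open Graph public

record Hypergraph (n : ℕ) : Set₁ where
  field
    Edge : Set
    edge : Edge → Subset n
open Hypergraph public

nbhd : ∀ {n} → Graph n → Fin n → Subset n
nbhd G v = tabulate (adj G v)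

nbhdHypergraph : ∀ {n} → Graph n → Hypergraph n
nbhdHypergraph {n} G = record { Edge = Fin n ; edge = nbhd G }

colorClass : ∀ {n m} → (Fin n → Fin m) → Fin m → Subset n
colorClass c i = tabulate (λ x → does (c x ≟ i))

IsKCFHyp : ∀ {n m} → ℕ → Hypergraph n → (Fin n → Fin m) → Set
IsKCFHyp k H c =
  ∀ e → Nonempty (edge H e) →
    ∃ λ i → 1 ≤ ∣ edge H e ∩ colorClass c i ∣ × ∣ edge H e ∩ colorClass c i ∣ ≤ k

IsKCF : ∀ {n m} → ℕ → Graph n → (Fin n → Fin m) → Set
IsKCF k G c = IsKCFHyp k (nbhdHypergraph G) c

-- G' (on Fin N) is obtained from G (on Fin t) by adding, for every
-- (k+1)-element subset K of V(G), a new vertex v_K adjacent exactly to K.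
-- (Described up to isomorphism: an explicit identification of V(G') with
-- V(G) ⊎ {(k+1)-subsets of V(G)} and the adjacency relations.)
record IsExtension {t N : ℕ} (k : ℕ) (G : Graph t) (G' : Graph N) : Set where
  field
    old     : Fin t → Fin N
    new     : (K : Subset t) → ∣ K ∣ ≡ suc k → Fin N
    old-inj : ∀ u v → old u ≡ old v → u ≡ v
    new-inj : ∀ K p K' p' → new K p ≡ new K' p' → K ≡ K'
    old≢new : ∀ u K p → ¬ (old u ≡ new K p)
    cover   : ∀ x → (∃ λ u → old u ≡ x) ⊎ (∃₂ λ K p → new K p ≡ x)
    adj-old-old : ∀ u v → adj G' (old u) (old v) ≡ adj G u v
    adj-old-new : ∀ u K p → adj G' (old u) (new K p) ≡ lookup K u
    adj-new-new : ∀ K p K' p' → adj G' (new K p) (new K' p') ≡ false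

module Submission where

-- Let c be a k-CF-colouring of G' with m colours.  The key observation is that
-- no colour can occur more than k times on the original vertices V(G): if
-- k+1 original vertices K all had colour i₀, the hub v_K (whose neighbourhood
-- is exactly K) would have a monochromatic neighbourhood of size k+1, so its
-- only colour i₀ would occur more than k times, violating the CF condition.
-- Since the m colour classes partition the t original vertices, t ≤ k·m.

open import Defs
open import Data.Nat using (ℕ; _≤_; _+_; _*_)
open import Data.Fin using (Fin)

import Algebra.Properties.Monoid.Sum as Sum
open import Data.Bool using (Bool; true)
open import Data.Empty using (⊥-elim)
open import Data.Fin using (zero; suc; _≟_)
open import Data.Fin.Properties using (suc-injective; 0≢1+n)
open import Data.Fin.Subset using (Subset; _∩_; ∣_∣; Nonempty; _∈_; _⊆_; _-_; inside; outside; ⊥)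
open import Data.Fin.Subset.Properties
  using (x∈p∩q⁺; x∈p∩q⁻; x∈p∧x≢y⇒x∈p-y; x∈p⇒∣p-x∣<∣p∣; ∣⊥∣≡0; ∉⊥; nonempty?; Empty-unique)
open import Data.Nat using (zero; suc; z≤n; s≤s; _≤?_)
open import Data.Nat.Properties using (≤-trans; ≤-reflexive; +-mono-≤; *-suc; +-suc; ≰⇒>; 1+n≰n; +-0-monoid)
open import Data.Product using (∃; _×_; _,_)
open import Data.Sum using (inj₁; inj₂)
open import Data.Vec using (_∷_; []; tabulate; lookup; here; there)
open import Data.Vec.Properties using ([]=⇒lookup; lookup⇒[]=; lookup∘tabulate)
open import Function using (_∘_)
open import Relation.Nullary using (¬_; yes; no; does)
open import Relation.Nullary.Decidable using (dec-true)
open import Relation.Nullary.Negation using (contradiction)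
open import Relation.Binary.PropositionalEquality
  using (_≡_; refl; trans; cong; subst) renaming (sym to ≡-sym)

open Sum +-0-monoid using (sum; sum-replicate-zero)

∈-tabulate⁻ : ∀ {n} (f : Fin n → Bool) {x : Fin n} → x ∈ tabulate f → f x ≡ true
∈-tabulate⁻ f {x} x∈ = trans (≡-sym (lookup∘tabulate f x)) ([]=⇒lookup x∈)

∈-tabulate⁺ : ∀ {n} (f : Fin n → Bool) {x : Fin n} → f x ≡ true → x ∈ tabulate f
∈-tabulate⁺ f {x} fx = lookup⇒[]= x (tabulate f) (trans (lookup∘tabulate f x) fx)

∈-colorClass⁻ : ∀ {n m} (c : Fin n → Fin m) {i : Fin m} {x : Fin n} →
  x ∈ colorClass c i → c x ≡ i
∈-colorClass⁻ c {i} {x} x∈ with c x ≟ i | ∈-tabulate⁻ (λ y → does (c y ≟ i)) x∈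
... | yes cx≡i | _ = cx≡i
... | no _     | ()

∈-colorClass⁺ : ∀ {n m} (c : Fin n → Fin m) {i : Fin m} {x : Fin n} →
  c x ≡ i → x ∈ colorClass c i
∈-colorClass⁺ c {i} {x} cx≡i = ∈-tabulate⁺ (λ y → does (c y ≟ i)) (dec-true (c x ≟ i) cx≡i)

positive⇒nonempty : ∀ {n} (p : Subset n) → 1 ≤ ∣ p ∣ → Nonempty p
positive⇒nonempty {n} p 1≤∣p∣ with nonempty? p
... | yes ne = ne
... | no ¬ne = contradiction (≤-trans 1≤∣p∣ (≤-reflexive ∣p∣≡0)) λ ()
  where
  ∣p∣≡0 : ∣ p ∣ ≡ 0
  ∣p∣≡0 = trans (cong ∣_∣ (Empty-unique ¬ne)) (∣⊥∣≡0 n)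

subset-of-size : ∀ {n} (S : Subset n) j → j ≤ ∣ S ∣ → ∃ λ T → T ⊆ S × ∣ T ∣ ≡ j
subset-of-size {n} S zero _ = ⊥ , (λ x∈⊥ → ⊥-elim (∉⊥ x∈⊥)) , ∣⊥∣≡0 n
subset-of-size (outside ∷ S) (suc j) j<∣S∣ with subset-of-size S (suc j) j<∣S∣
... | T , T⊆S , ∣T∣≡ = outside ∷ T , (λ { (there x∈T) → there (T⊆S x∈T) }) , ∣T∣≡
subset-of-size (inside ∷ S) (suc j) (s≤s j≤∣S∣) with subset-of-size S j j≤∣S∣
... | T , T⊆S , ∣T∣≡ =
  inside ∷ T , (λ { here → here ; (there x∈T) → there (T⊆S x∈T) }) , cong suc ∣T∣≡

injection-size : ∀ {t N} (f : Fin t → Fin N) → (∀ u v → f u ≡ f v → u ≡ v) →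
  (K : Subset t) (S : Subset N) → (∀ u → u ∈ K → f u ∈ S) → ∣ K ∣ ≤ ∣ S ∣
injection-size {zero} f f-inj [] S f[K]⊆S = z≤n
injection-size {suc t} f f-inj (outside ∷ K) S f[K]⊆S =
  injection-size (f ∘ suc) (λ u v eq → suc-injective (f-inj _ _ eq)) K S
    (λ u u∈K → f[K]⊆S (suc u) (there u∈K))
injection-size {suc t} f f-inj (inside ∷ K) S f[K]⊆S =
  ≤-trans (s≤s rest) (x∈p⇒∣p-x∣<∣p∣ (f[K]⊆S zero here))
  where
  rest : ∣ K ∣ ≤ ∣ S - f zero ∣
  rest = injection-size (f ∘ suc) (λ u v eq → suc-injective (f-inj _ _ eq)) K (S - f zero)
    (λ u u∈K → x∈p∧x≢y⇒x∈p-y (f[K]⊆S (suc u) (there u∈K))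
                              (λ eq → 0≢1+n (≡-sym (f-inj _ _ eq))))

-- Adding a point of colour a to every colour class of a colouring raises the
-- total size of the classes by exactly one.
sum-insert : ∀ {n} m (a : Fin m) (p : Fin m → Subset n) →
  sum (λ i → ∣ does (a ≟ i) ∷ p i ∣) ≡ suc (sum (λ i → ∣ p i ∣))
sum-insert (suc m) zero    p = refl
sum-insert (suc m) (suc a) p = trans (cong (∣ p zero ∣ +_) (sum-insert m a (p ∘ suc)))
                                     (+-suc ∣ p zero ∣ _)

colour-classes-partition : ∀ t m (c : Fin t → Fin m) → sum (λ i → ∣ colorClass c i ∣) ≡ t
colour-classes-partition zero    m c = sum-replicate-zero m
colour-classes-partition (suc t) m c =
  trans (sum-insert m (c zero) (colorClass (c ∘ suc)))
        (cong suc (colour-classes-partition t m (c ∘ suc)))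

sum-bound : ∀ k m (f : Fin m → ℕ) → (∀ i → f i ≤ k) → sum f ≤ k * m
sum-bound k zero    f f≤k = z≤n
sum-bound k (suc m) f f≤k =
  subst (sum f ≤_) (≡-sym (*-suc k m)) (+-mono-≤ (f≤k zero) (sum-bound k m (f ∘ suc) (f≤k ∘ suc)))

pigeonhole : ∀ {t m} k (c : Fin t → Fin m) → (∀ i → ∣ colorClass c i ∣ ≤ k) → t ≤ k * m
pigeonhole {t} {m} k c small =
  subst (_≤ k * m) (colour-classes-partition t m c) (sum-bound k m _ small)

module Extension {k t N} {G : Graph t} {G' : Graph N} (ext : IsExtension k G G') where
  open IsExtension ext

  module Hub (K : Subset t) (∣K∣≡ : ∣ K ∣ ≡ suc k) where
    hub : Fin N
    hub = new K ∣K∣≡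

    adj-hub-old : ∀ u → adj G' hub (old u) ≡ lookup K u
    adj-hub-old u = trans (Graph.sym G' hub (old u)) (adj-old-new u K ∣K∣≡)

    old∈nbhd-hub : ∀ {u} → u ∈ K → old u ∈ nbhd G' hub
    old∈nbhd-hub {u} u∈K = ∈-tabulate⁺ (adj G' hub) (trans (adj-hub-old u) ([]=⇒lookup u∈K))

    -- The hub has no other neighbours: hubs are pairwise non-adjacent.
    nbhd-hub⊆old[K] : ∀ {x} → x ∈ nbhd G' hub → ∃ λ u → old u ≡ x × u ∈ K
    nbhd-hub⊆old[K] {x} x∈ with cover x | ∈-tabulate⁻ (adj G' hub) x∈
    ... | inj₁ (u , refl)      | adj≡true =
      u , refl , lookup⇒[]= u K (trans (≡-sym (adj-hub-old u)) adj≡true)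
    ... | inj₂ (K' , p' , refl) | adj≡true
      with () ← trans (≡-sym adj≡true) (adj-new-new K ∣K∣≡ K' p')

    hub-nonempty : Nonempty (nbhd G' hub)
    hub-nonempty with positive⇒nonempty K (subst (1 ≤_) (≡-sym ∣K∣≡) (s≤s z≤n))
    ... | u , u∈K = old u , old∈nbhd-hub u∈K

    module _ {m} (c : Fin N → Fin m) (i₀ : Fin m) (mono : ∀ {u} → u ∈ K → c (old u) ≡ i₀) where

      hub-sees-only-i₀ : ∀ {i x} → x ∈ nbhd G' hub ∩ colorClass c i → i ≡ i₀
      hub-sees-only-i₀ {i} x∈ with x∈p∩q⁻ (nbhd G' hub) (colorClass c i) x∈
      ... | x∈A , x∈Ci with nbhd-hub⊆old[K] x∈A
      ... | u , refl , u∈K = trans (≡-sym (∈-colorClass⁻ c x∈Ci)) (mono u∈K)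

      hub-sees-i₀-often : suc k ≤ ∣ nbhd G' hub ∩ colorClass c i₀ ∣
      hub-sees-i₀-often = subst (_≤ ∣ nbhd G' hub ∩ colorClass c i₀ ∣) ∣K∣≡
        (injection-size old old-inj K _ λ u u∈K →
          x∈p∩q⁺ (old∈nbhd-hub u∈K , ∈-colorClass⁺ c (mono u∈K)))

      monochromatic-hub : ¬ IsKCF k G' c
      monochromatic-hub kcf with kcf hub hub-nonempty
      ... | i , 1≤∣Ci∣ , ∣Ci∣≤k with positive⇒nonempty _ 1≤∣Ci∣
      ... | x , x∈ with refl ← hub-sees-only-i₀ x∈ =
        1+n≰n (≤-trans hub-sees-i₀-often ∣Ci∣≤k)

  -- In a k-CF-colouring of G', each colour occurs at most k times on V(G):
  -- otherwise k+1 original vertices of one colour give a monochromatic hub.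
  original-classes-small : ∀ {m} (c : Fin N → Fin m) → IsKCF k G' c →
    ∀ i → ∣ colorClass (c ∘ old) i ∣ ≤ k
  original-classes-small c kcf i with ∣ colorClass (c ∘ old) i ∣ ≤? k
  ... | yes small = small
  ... | no ¬small with subset-of-size (colorClass (c ∘ old) i) (suc k) (≰⇒> ¬small)
  ... | K , K⊆Ci , ∣K∣≡ =
    ⊥-elim (Hub.monochromatic-hub K ∣K∣≡ c i (λ u∈K → ∈-colorClass⁻ (c ∘ old) (K⊆Ci u∈K)) kcf)

-- Proposition 5: χ_{k-cf}(G') ≥ t / k, i.e. every k-CF-colouring of G' with m
-- colours has t ≤ k·m.
proposition5 : (k t N : ℕ) → 1 ≤ k → k + 2 ≤ t →
    (G : Graph t) (G' : Graph N) → IsExtension k G G' →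
    (m : ℕ) (c : Fin N → Fin m) → IsKCF k G' c →
    t ≤ k * m
proposition5 k t N _ _ G G' ext m c kcf =
  pigeonhole k (c ∘ IsExtension.old ext) (Extension.original-classes-small ext c kcf)
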